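{- Let $D$ be a delta-matroid on $[n,\overline n]$ and let $\square=[-1,1]^n$. The map $S\mapsto e_S$ induces a bijection between the independent sets of $D$ and the lattice points of $\frac12(P(D)+\square)$.
   Context: Let $[n,\overline{n}]=\{1,\dots,n,\overline{1},\dots,\overline{n}\}$ with involution $a\mapsto\overline a$. Admissible sets contain at most one of $i,\overline i$ for each $i$. Set $e_{\overline i}=-e_i\in\mathbb{R}^n$ and $e_S=\sum_{a\in S}e_a$. A delta-matroid $D$ on $[n,\overline n]$ is a non-empty collection $\mathcal F$ of admissible sets of size $n$ (feasible sets) such that $P(D)=\operatorname{Conv}\{e_B:B\in\mathcal F\}$ has all edges parallel to some $e_i$ or $e_i\pm e_j$. An admissible set is independent in $D$ if it is contained in a feasible set. $P(D)+\square$ is the Minkowski sum.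
   Formalization: Membership of a lattice point in $\frac12(P(D)+\square)$ is witnessed by rational rather than real convex coefficients of the points $e_B$. -}

module Defs where

open import Data.Nat using (ℕ; zero; suc)
import Data.Nat as ℕ
open import Data.Fin using (Fin; zero; suc; _≟_)
open import Data.Fin.Subset using (Subset; Side; inside; outside; _∈_; _⊆_; ∣_∣)
open import Data.Vec using (Vec)
import Data.Vec as Vec
open import Data.Integer as ℤ using (ℤ; +_; -_)
open import Data.Rational as ℚ using (ℚ; _/_; 0ℚ; 1ℚ)
open import Data.List using (List; []; _∷_; length; lookup)
import Data.List.Membership.Propositional as LM
open import Data.Product using (Σ; ∃; ∃-syntax; _×_; _,_; proj₁; proj₂)
open import Data.Sum using (_⊎_)
open import Data.Empty using (⊥)
open import Relation.Nullary using (¬_; yes; no)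
open import Relation.Binary.PropositionalEquality using (_≡_; _≢_)

-- A subset S of [n, n̄] is encoded as a pair (P , N) of subsets of [n]:
-- P = S ∩ {1..n}, N = { i | ī ∈ S }.
SSet : ℕ → Set
SSet n = Subset n × Subset n

Admissible : ∀ {n} → SSet n → Set
Admissible (P , N) = ∀ i → i ∈ P → i ∈ N → ⊥

card : ∀ {n} → SSet n → ℕ
card (P , N) = ∣ P ∣ ℕ.+ ∣ N ∣

_⊆±_ : ∀ {n} → SSet n → SSet n → Set
(P , N) ⊆± (P′ , N′) = (P ⊆ P′) × (N ⊆ N′)

indicator : ∀ {n} → Subset n → Fin n → ℤ
indicator P i with Vec.lookup P i
... | inside = + 1
... | outside = + 0

eS : ∀ {n} → SSet n → Fin n → ℤ
eS (P , N) i = indicator P i ℤ.- indicator N i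

sumℤ : ∀ {m} → (Fin m → ℤ) → ℤ
sumℤ {zero} f = + 0
sumℤ {suc m} f = f zero ℤ.+ sumℤ (λ k → f (suc k))

sumℚ : ∀ {m} → (Fin m → ℚ) → ℚ
sumℚ {zero} f = 0ℚ
sumℚ {suc m} f = f zero ℚ.+ sumℚ (λ k → f (suc k))

dot : ∀ {n} → (Fin n → ℤ) → (Fin n → ℤ) → ℤ
dot w x = sumℤ (λ i → w i ℤ.* x i)

unit : ∀ {n} → Fin n → Fin n → ℤ
unit i k with i ≟ k
... | yes _ = + 1
... | no _ = + 0

-- Feasible sets A, B ∈ F span an edge of P(D) = Conv{e_B : B ∈ F}:
-- e_A ≠ e_B and some linear functional w attains its maximum over the
-- vertices exactly at e_A and e_B (the points e_B are ±1-vectors, so no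
-- three are collinear and a 1-dimensional face has exactly two vertices).
IsEdge : ∀ {n} → List (SSet n) → SSet n → SSet n → Set
IsEdge {n} F A B =
  (∃[ i ] eS A i ≢ eS B i) ×
  (∃[ w ] ((∀ C → C LM.∈ F → dot w (eS C) ℤ.≤ dot w (eS A)) ×
           (dot w (eS A) ≡ dot w (eS B)) ×
           (∀ C → C LM.∈ F → dot w (eS C) ≡ dot w (eS A) →
              (∀ i → eS C i ≡ eS A i) ⊎ (∀ i → eS C i ≡ eS B i))))

ParallelToRoot : ∀ {n} → (Fin n → ℤ) → Set
ParallelToRoot {n} d =
  (∃[ c ] ∃[ i ] ∀ k → d k ≡ c ℤ.* unit i k) ⊎
  (∃[ c ] ∃[ i ] ∃[ j ] (i ≢ j) × ∃[ s ] ((s ≡ + 1) ⊎ (s ≡ - (+ 1))) ×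
      (∀ k → d k ≡ c ℤ.* (unit i k ℤ.+ s ℤ.* unit j k)))

IsDeltaMatroid : (n : ℕ) → List (SSet n) → Set
IsDeltaMatroid n F =
  (F ≢ []) ×
  (∀ B → B LM.∈ F → Admissible B × (card B ≡ n)) ×
  (∀ A B → A LM.∈ F → B LM.∈ F → IsEdge F A B →
     ParallelToRoot (λ i → eS A i ℤ.- eS B i))

Independent : ∀ {n} → List (SSet n) → SSet n → Set
Independent F S = Admissible S × ∃[ B ] (B LM.∈ F) × (S ⊆± B)

ℤtoℚ : ℤ → ℚ
ℤtoℚ z = z / 1

-- x ∈ ℤⁿ lies in ½ (P(D) + □), □ = [-1,1]ⁿ:
-- 2x = p + c with p a convex combination of the e_B (B ∈ F) and c ∈ □.
InHalfSum : ∀ {n} → List (SSet n) → (Fin n → ℤ) → Set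
InHalfSum {n} F x =
  ∃[ λ′ ] ((∀ k → 0ℚ ℚ.≤ λ′ k) × (sumℚ λ′ ≡ 1ℚ) ×
    (∀ i → let y = ℤtoℚ (+ 2 ℤ.* x i) ℚ.- sumℚ (λ k → λ′ k ℚ.* ℤtoℚ (eS (lookup F k) i))
           in (ℚ.- 1ℚ ℚ.≤ y) × (y ℚ.≤ 1ℚ)))

-- A lattice point x of ½(P(D) + □) satisfies 2xᵢ = pᵢ + yᵢ with p = Σ λ_B e_B
-- a convex combination of vertices and yᵢ ∈ [-1, 1]. Hence xᵢ ∈ {-1, 0, 1}, and
-- xᵢ = ±1 forces pᵢ = ±1; since pᵢ averages values in [-1, 1], every B with
-- λ_B > 0 then has (e_B)ᵢ = xᵢ. So x = e_S for the admissible set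
-- S = {i ∣ xᵢ = 1} ∪ {ī ∣ xᵢ = -1}, which lies inside any such B, and S is
-- recovered from e_S in this way. Conversely, for S ⊆ B feasible, 2e_S − e_B ∈ □.
module Submission where

open import Data.Bool.Base using (b≤b) renaming (_≤_ to _≤ₛ_)
open import Data.Bool.Properties using () renaming (≤-minimum to ≤ₛ-minimum)
open import Data.Empty using (⊥; ⊥-elim)
open import Data.Fin using (Fin; zero; suc)
open import Data.Fin.Properties using (any?)
open import Data.Fin.Subset using (Subset; Side; inside; outside; _⊆_)
open import Data.Integer as ℤ using (ℤ; +_; -[1+_]; +≤+; -≤-)
import Data.Integer.Properties as ℤP
open import Data.List using (List; lookup)
import Data.List.Membership.Propositional as List
open import Data.List.Membership.Propositional.Properties using (∈-lookup)
open import Data.List.Relation.Unary.Any using (index)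
open import Data.List.Relation.Unary.Any.Properties using (lookup-index)
open import Data.Nat using (ℕ; zero; suc; s≤s)
import Data.Nat.Coprimality as Coprime
import Data.Nat.Properties as ℕP
open import Data.Product using (∃-syntax; _×_; _,_; proj₁; proj₂)
open import Data.Rational as ℚ
  using (ℚ; mkℚ; 0ℚ; 1ℚ; _+_; _*_; -_; _-_; _≤_; _<_; nonNegative; positive)
import Data.Rational.Properties as ℚP
open import Data.Rational.Solver using (module +-*-Solver)
open import Data.Sum using (_⊎_; inj₁; inj₂)
open import Data.Unit using (tt)
import Data.Vec as Vec
import Data.Vec.Properties as VecP
open import Relation.Binary.PropositionalEquality
open import Relation.Nullary using (¬_; yes; no)

open import Defs

sumℚ-cong : ∀ {m} {f g : Fin m → ℚ} → (∀ k → f k ≡ g k) → sumℚ f ≡ sumℚ g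
sumℚ-cong {zero}  f≡g = refl
sumℚ-cong {suc m} f≡g = cong₂ _+_ (f≡g zero) (sumℚ-cong (λ k → f≡g (suc k)))

sumℚ-zero : ∀ m → sumℚ {m} (λ _ → 0ℚ) ≡ 0ℚ
sumℚ-zero zero    = refl
sumℚ-zero (suc m) = trans (ℚP.+-identityˡ _) (sumℚ-zero m)

sumℚ-neg : ∀ {m} (f : Fin m → ℚ) → sumℚ (λ k → - f k) ≡ - sumℚ f
sumℚ-neg {zero}  f = refl
sumℚ-neg {suc m} f =
  trans (cong (_+_ (- f zero)) (sumℚ-neg (λ k → f (suc k))))
        (sym (ℚP.neg-distrib-+ (f zero) _))

sumℚ-mono-≤ : ∀ {m} {f g : Fin m → ℚ} → (∀ k → f k ≤ g k) → sumℚ f ≤ sumℚ g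
sumℚ-mono-≤ {zero}  f≤g = ℚP.≤-refl
sumℚ-mono-≤ {suc m} f≤g = ℚP.+-mono-≤ (f≤g zero) (sumℚ-mono-≤ (λ k → f≤g (suc k)))

sumℚ-mono-< : ∀ {m} {f g : Fin m → ℚ} → (∀ k → f k ≤ g k) →
              ∀ k → f k < g k → sumℚ f < sumℚ g
sumℚ-mono-< f≤g zero    fk<gk = ℚP.+-mono-<-≤ fk<gk (sumℚ-mono-≤ (λ k → f≤g (suc k)))
sumℚ-mono-< f≤g (suc k) fk<gk =
  ℚP.+-mono-≤-< (f≤g zero) (sumℚ-mono-< (λ k → f≤g (suc k)) k fk<gk)

sumℚ-mono-≤-tight : ∀ {m} {f g : Fin m → ℚ} → (∀ k → f k ≤ g k) →
                       sumℚ g ≤ sumℚ f → ∀ k → g k ≤ f k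
sumℚ-mono-≤-tight {f = f} {g} f≤g Σg≤Σf k with g k ℚP.≤? f k
... | yes gk≤fk = gk≤fk
... | no  gk≰fk =
  ⊥-elim (ℚP.<-irrefl refl (ℚP.<-≤-trans (sumℚ-mono-< f≤g k (ℚP.≰⇒> gk≰fk)) Σg≤Σf))

∃-positive : ∀ {m} (l : Fin m → ℚ) → (∀ k → 0ℚ ≤ l k) → sumℚ l ≡ 1ℚ → ∃[ k ] 0ℚ < l k
∃-positive {m} l l≥0 Σl≡1 with any? (λ k → 0ℚ ℚP.<? l k)
... | yes ∃l>0 = ∃l>0
... | no  ∄l>0 = ⊥-elim (1≰0 (subst₂ _≤_ Σl≡1 (sumℚ-zero m) (sumℚ-mono-≤ l≤0)))
  where
  l≤0 : ∀ k → l k ≤ 0ℚ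
  l≤0 k = ℚP.≮⇒≥ (λ 0<lk → ∄l>0 (k , 0<lk))
  1≰0 : ¬ (1ℚ ≤ 0ℚ)
  1≰0 = ℚP.≤⇒≤ᵇ

dirac : ∀ {m} → Fin m → Fin m → ℚ
dirac zero    zero    = 1ℚ
dirac zero    (suc _) = 0ℚ
dirac (suc _) zero    = 0ℚ
dirac (suc k) (suc j) = dirac k j

dirac-nonNeg : ∀ {m} (k j : Fin m) → 0ℚ ≤ dirac k j
dirac-nonNeg zero    zero    = ℚP.≤ᵇ⇒≤ tt
dirac-nonNeg zero    (suc _) = ℚP.≤-refl
dirac-nonNeg (suc _) zero    = ℚP.≤-refl
dirac-nonNeg (suc k) (suc j) = dirac-nonNeg k j

sumℚ-zero* : ∀ {m} (v : Fin m → ℚ) → sumℚ (λ j → 0ℚ * v j) ≡ 0ℚ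
sumℚ-zero* {m} v = trans (sumℚ-cong (λ j → ℚP.*-zeroˡ (v j))) (sumℚ-zero m)

sumℚ-dirac-* : ∀ {m} (k : Fin m) (v : Fin m → ℚ) → sumℚ (λ j → dirac k j * v j) ≡ v k
sumℚ-dirac-* zero    v = trans (cong₂ _+_ (ℚP.*-identityˡ (v zero)) (sumℚ-zero* (λ j → v (suc j))))
                              (ℚP.+-identityʳ (v zero))
sumℚ-dirac-* (suc k) v = trans (cong₂ _+_ (ℚP.*-zeroˡ (v zero)) (sumℚ-dirac-* k (λ j → v (suc j))))
                              (ℚP.+-identityˡ (v (suc k)))

sumℚ-dirac : ∀ {m} (k : Fin m) → sumℚ (dirac k) ≡ 1ℚ
sumℚ-dirac k = trans (sumℚ-cong (λ j → sym (ℚP.*-identityʳ (dirac k j)))) (sumℚ-dirac-* k (λ _ → 1ℚ))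

In□ : ℚ → Set
In□ q = (- 1ℚ ≤ q) × (q ≤ 1ℚ)

w*v≤w : ∀ {w v} → 0ℚ ≤ w → v ≤ 1ℚ → w * v ≤ w
w*v≤w {w} 0≤w v≤1 =
  subst (w * _ ≤_) (ℚP.*-identityʳ w) (ℚP.*-monoˡ-≤-nonNeg w {{nonNegative 0≤w}} v≤1)

*-neg-identityʳ : ∀ w → w * - 1ℚ ≡ - w
*-neg-identityʳ w = trans (sym (ℚP.neg-distribʳ-* w 1ℚ)) (cong -_ (ℚP.*-identityʳ w))

-w≤w*v : ∀ {w v} → 0ℚ ≤ w → - 1ℚ ≤ v → - w ≤ w * v
-w≤w*v {w} 0≤w -1≤v =
  subst (_≤ w * _) (*-neg-identityʳ w) (ℚP.*-monoˡ-≤-nonNeg w {{nonNegative 0≤w}} -1≤v)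

module _ {m} (l : Fin m → ℚ) (l≥0 : ∀ k → 0ℚ ≤ l k) (Σl≡1 : sumℚ l ≡ 1ℚ) where

  private
    Σ-l≡-1 : sumℚ (λ k → - l k) ≡ - 1ℚ
    Σ-l≡-1 = trans (sumℚ-neg l) (cong -_ Σl≡1)

  convex-In□ : (v : Fin m → ℚ) → (∀ k → In□ (v k)) → In□ (sumℚ (λ k → l k * v k))
  convex-In□ v v∈□ =
      subst (_≤ sumℚ lv) Σ-l≡-1 (sumℚ-mono-≤ (λ k → -w≤w*v (l≥0 k) (proj₁ (v∈□ k))))
    , subst (sumℚ lv ≤_) Σl≡1 (sumℚ-mono-≤ {f = lv} (λ k → w*v≤w (l≥0 k) (proj₂ (v∈□ k))))
    where lv = λ k → l k * v k

  convex-≥1 : (v : Fin m → ℚ) → (∀ k → v k ≤ 1ℚ) → 1ℚ ≤ sumℚ (λ k → l k * v k) →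
              ∀ k → 0ℚ < l k → 1ℚ ≤ v k
  convex-≥1 v v≤1 1≤Σ k 0<lk = ℚP.*-cancelˡ-≤-pos (l k) {{positive 0<lk}}
    (subst (_≤ l k * v k) (sym (ℚP.*-identityʳ (l k)))
      (sumℚ-mono-≤-tight {f = λ j → l j * v j} (λ j → w*v≤w (l≥0 j) (v≤1 j))
        (subst (_≤ sumℚ (λ j → l j * v j)) (sym Σl≡1) 1≤Σ) k))

  convex-≤-1 : (v : Fin m → ℚ) → (∀ k → - 1ℚ ≤ v k) → sumℚ (λ k → l k * v k) ≤ - 1ℚ →
               ∀ k → 0ℚ < l k → v k ≤ - 1ℚ
  convex-≤-1 v -1≤v Σ≤-1 k 0<lk = ℚP.*-cancelˡ-≤-pos (l k) {{positive 0<lk}}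
    (subst (l k * v k ≤_) (sym (*-neg-identityʳ (l k)))
      (sumℚ-mono-≤-tight {g = λ j → l j * v j} (λ j → -w≤w*v (l≥0 j) (-1≤v j))
        (subst (sumℚ (λ j → l j * v j) ≤_) (sym Σ-l≡-1) Σ≤-1) k))

ℤtoℚ≡mkℚ : ∀ z → ℤtoℚ z ≡ mkℚ z 0 (Coprime.sym (Coprime.1-coprimeTo _))
ℤtoℚ≡mkℚ z = ℚP.↥p/↧p≡p (mkℚ z 0 (Coprime.sym (Coprime.1-coprimeTo _)))

ℤtoℚ-cancel-≤ : ∀ {a b} → ℤtoℚ a ≤ ℤtoℚ b → a ℤ.≤ b
ℤtoℚ-cancel-≤ {a} {b} a≤b with subst₂ _≤_ (ℤtoℚ≡mkℚ a) (ℤtoℚ≡mkℚ b) a≤b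
... | ℚ.*≤* a*1≤b*1 = subst₂ ℤ._≤_ (ℤP.*-identityʳ a) (ℤP.*-identityʳ b) a*1≤b*1

module _ where
  open +-*-Solver

  p-q+q≡p : ∀ p q → (p - q) + q ≡ p
  p-q+q≡p = solve 2 (λ p q → (p :- q) :+ q := p) refl

  p-[p-q]≡q : ∀ p q → p - (p - q) ≡ q
  p-[p-q]≡q = solve 2 (λ p q → p :- (p :- q) := q) refl

double-bounded⇒trit : ∀ x → -[1+ 1 ] ℤ.≤ + 2 ℤ.* x → + 2 ℤ.* x ℤ.≤ + 2 →
                      (x ≡ + 0) ⊎ (x ≡ + 1) ⊎ (x ≡ -[1+ 0 ])
double-bounded⇒trit (+ 0)           _             _                   = inj₁ refl
double-bounded⇒trit (+ 1)           _             _                   = inj₂ (inj₁ refl)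
double-bounded⇒trit -[1+ 0 ]        _             _                   = inj₂ (inj₂ refl)
double-bounded⇒trit (+ suc (suc n)) _             (+≤+ (s≤s (s≤s h))) with () ← ℕP.m+n≤o⇒n≤o n h
double-bounded⇒trit -[1+ suc n ]    (-≤- (s≤s h)) _                   with () ← ℕP.m+n≤o⇒n≤o n h

halfSum-coordinate : ∀ x p → In□ p → In□ (ℤtoℚ (+ 2 ℤ.* x) - p) →
  (x ≡ + 0) ⊎ ((x ≡ + 1) × (1ℚ ≤ p)) ⊎ ((x ≡ -[1+ 0 ]) × (p ≤ - 1ℚ))
halfSum-coordinate x p (-1≤p , p≤1) (-1≤y , y≤1) = refine (double-bounded⇒trit x -2≤2x 2x≤2)
  where
  a = ℤtoℚ (+ 2 ℤ.* x)
  -2≤2x : -[1+ 1 ] ℤ.≤ + 2 ℤ.* x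
  -2≤2x = ℤtoℚ-cancel-≤ (subst (ℤtoℚ -[1+ 1 ] ≤_) (p-q+q≡p a p) (ℚP.+-mono-≤ -1≤y -1≤p))
  2x≤2 : + 2 ℤ.* x ℤ.≤ + 2
  2x≤2 = ℤtoℚ-cancel-≤ (subst (_≤ ℤtoℚ (+ 2)) (p-q+q≡p a p) (ℚP.+-mono-≤ y≤1 p≤1))
  a-1≤p : a - 1ℚ ≤ p
  a-1≤p = subst (a - 1ℚ ≤_) (p-[p-q]≡q a p) (ℚP.+-monoʳ-≤ a (ℚP.neg-antimono-≤ y≤1))
  p≤a+1 : p ≤ a + 1ℚ
  p≤a+1 = subst (_≤ a + 1ℚ) (p-[p-q]≡q a p) (ℚP.+-monoʳ-≤ a (ℚP.neg-antimono-≤ -1≤y))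
  refine : (x ≡ + 0) ⊎ (x ≡ + 1) ⊎ (x ≡ -[1+ 0 ]) →
           (x ≡ + 0) ⊎ ((x ≡ + 1) × (1ℚ ≤ p)) ⊎ ((x ≡ -[1+ 0 ]) × (p ≤ - 1ℚ))
  refine (inj₁ x≡0)        = inj₁ x≡0
  refine (inj₂ (inj₁ x≡1)) = inj₂ (inj₁ (x≡1 , subst (λ z → ℤtoℚ (+ 2 ℤ.* z) - 1ℚ ≤ p) x≡1 a-1≤p))
  refine (inj₂ (inj₂ x≡-1)) = inj₂ (inj₂ (x≡-1 , subst (λ z → p ≤ ℤtoℚ (+ 2 ℤ.* z) + 1ℚ) x≡-1 p≤a+1))

side→ℤ : Side → ℤ
side→ℤ inside  = + 1
side→ℤ outside = + 0

signed : Side → Side → ℤ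
signed a b = side→ℤ a ℤ.- side→ℤ b

eS-lookup : ∀ {n} (S : SSet n) i → eS S i ≡ signed (Vec.lookup (proj₁ S) i) (Vec.lookup (proj₂ S) i)
eS-lookup (P , N) i = cong₂ ℤ._-_ (indicator-lookup P) (indicator-lookup N)
  where
  indicator-lookup : ∀ Q → indicator Q i ≡ side→ℤ (Vec.lookup Q i)
  indicator-lookup Q with Vec.lookup Q i
  ... | inside  = refl
  ... | outside = refl

signed-In□ : ∀ a b → In□ (ℤtoℚ (signed a b))
signed-In□ inside  inside  = ℚP.≤ᵇ⇒≤ tt , ℚP.≤ᵇ⇒≤ tt
signed-In□ inside  outside = ℚP.≤ᵇ⇒≤ tt , ℚP.≤ᵇ⇒≤ tt
signed-In□ outside inside  = ℚP.≤ᵇ⇒≤ tt , ℚP.≤ᵇ⇒≤ tt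
signed-In□ outside outside = ℚP.≤ᵇ⇒≤ tt , ℚP.≤ᵇ⇒≤ tt

DisjointSides : Side → Side → Set
DisjointSides a b = a ≡ inside → b ≡ inside → ⊥

-- SignedBelow z c d: z is the i-th coordinate of e_S for some S ⊆ B, where
-- c and d record whether i ∈ B and whether ī ∈ B.
data SignedBelow : ℤ → Side → Side → Set where
  none : ∀ {c d} → SignedBelow (+ 0) c d
  pos  : ∀ {d} → SignedBelow (+ 1) inside d
  neg  : ∀ {c} → SignedBelow -[1+ 0 ] c inside

signed-mono : ∀ {a b c d} → a ≤ₛ c → b ≤ₛ d → SignedBelow (signed a b) c d
signed-mono {outside} {outside} _   _   = none
signed-mono {inside}  {outside} b≤b _   = pos
signed-mono {outside} {inside}  _   b≤b = neg
signed-mono {inside}  {inside}  _   _   = none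

signedBelow-In□ : ∀ {z c d} → DisjointSides c d → SignedBelow z c d →
                  In□ (ℤtoℚ (+ 2 ℤ.* z) - ℤtoℚ (signed c d))
signedBelow-In□ {c = inside}  {inside}  c∩d=∅ _     = ⊥-elim (c∩d=∅ refl refl)
signedBelow-In□ {c = inside}  {outside} _     none = ℚP.≤ᵇ⇒≤ tt , ℚP.≤ᵇ⇒≤ tt
signedBelow-In□ {c = outside} {inside}  _     none = ℚP.≤ᵇ⇒≤ tt , ℚP.≤ᵇ⇒≤ tt
signedBelow-In□ {c = outside} {outside} _     none = ℚP.≤ᵇ⇒≤ tt , ℚP.≤ᵇ⇒≤ tt
signedBelow-In□ {c = inside}  {outside} _     pos  = ℚP.≤ᵇ⇒≤ tt , ℚP.≤ᵇ⇒≤ tt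
signedBelow-In□ {c = outside} {inside}  _     neg  = ℚP.≤ᵇ⇒≤ tt , ℚP.≤ᵇ⇒≤ tt

signedBelow-intro : ∀ {z} c d →
  (z ≡ + 0) ⊎ ((z ≡ + 1) × (1ℚ ≤ ℤtoℚ (signed c d))) ⊎ ((z ≡ -[1+ 0 ]) × (ℤtoℚ (signed c d) ≤ - 1ℚ)) →
  SignedBelow z c d
signedBelow-intro c       d       (inj₁ refl)               = none
signedBelow-intro inside  d       (inj₂ (inj₁ (refl , _)))  = pos
signedBelow-intro outside inside  (inj₂ (inj₁ (refl , 1≤))) = ⊥-elim (ℚP.≤⇒≤ᵇ 1≤)
signedBelow-intro outside outside (inj₂ (inj₁ (refl , 1≤))) = ⊥-elim (ℚP.≤⇒≤ᵇ 1≤)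
signedBelow-intro c       inside  (inj₂ (inj₂ (refl , _)))  = neg
signedBelow-intro inside  outside (inj₂ (inj₂ (refl , ≤-1))) = ⊥-elim (ℚP.≤⇒≤ᵇ ≤-1)
signedBelow-intro outside outside (inj₂ (inj₂ (refl , ≤-1))) = ⊥-elim (ℚP.≤⇒≤ᵇ ≤-1)

isOne : ℤ → Side
isOne (+ 1) = inside
isOne _     = outside

isMinusOne : ℤ → Side
isMinusOne -[1+ 0 ] = inside
isMinusOne _        = outside

isOne-signed : ∀ {a b} → DisjointSides a b → isOne (signed a b) ≡ a
isOne-signed {inside}  {inside}  a∩b=∅ = ⊥-elim (a∩b=∅ refl refl)
isOne-signed {inside}  {outside} _     = refl
isOne-signed {outside} {inside}  _     = refl
isOne-signed {outside} {outside} _     = refl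

isMinusOne-signed : ∀ {a b} → DisjointSides a b → isMinusOne (signed a b) ≡ b
isMinusOne-signed {inside}  {inside}  a∩b=∅ = ⊥-elim (a∩b=∅ refl refl)
isMinusOne-signed {inside}  {outside} _     = refl
isMinusOne-signed {outside} {inside}  _     = refl
isMinusOne-signed {outside} {outside} _     = refl

signed-isOne-isMinusOne : ∀ {z c d} → SignedBelow z c d → signed (isOne z) (isMinusOne z) ≡ z
signed-isOne-isMinusOne none = refl
signed-isOne-isMinusOne pos  = refl
signed-isOne-isMinusOne neg  = refl

isOne-≤ : ∀ {z c d} → SignedBelow z c d → isOne z ≤ₛ c
isOne-≤ {c = c} none = ≤ₛ-minimum c
isOne-≤         pos  = b≤b
isOne-≤ {c = c} neg  = ≤ₛ-minimum c

isMinusOne-≤ : ∀ {z c d} → SignedBelow z c d → isMinusOne z ≤ₛ d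
isMinusOne-≤ {d = d} none = ≤ₛ-minimum d
isMinusOne-≤ {d = d} pos  = ≤ₛ-minimum d
isMinusOne-≤         neg  = b≤b

isOne-isMinusOne-disjoint : ∀ z → DisjointSides (isOne z) (isMinusOne z)
isOne-isMinusOne-disjoint (+ 1)    _ ()
isOne-isMinusOne-disjoint -[1+ 0 ] ()

admissible⇒disjoint : ∀ {n} {P N : Subset n} → Admissible (P , N) →
                      ∀ i → DisjointSides (Vec.lookup P i) (Vec.lookup N i)
admissible⇒disjoint {P = P} {N} adm i i∈P i∈N =
  adm i (VecP.lookup⇒[]= i P i∈P) (VecP.lookup⇒[]= i N i∈N)

disjoint⇒admissible : ∀ {n} {P N : Subset n} →
                      (∀ i → DisjointSides (Vec.lookup P i) (Vec.lookup N i)) → Admissible (P , N)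
disjoint⇒admissible disj i i∈P i∈N = disj i (VecP.[]=⇒lookup i∈P) (VecP.[]=⇒lookup i∈N)

⊆⇒lookup-≤ : ∀ {n} {P Q : Subset n} → P ⊆ Q → ∀ i → Vec.lookup P i ≤ₛ Vec.lookup Q i
⊆⇒lookup-≤ {P = P} {Q} P⊆Q i with Vec.lookup P i in i∈P
... | outside = ≤ₛ-minimum (Vec.lookup Q i)
... | inside  rewrite VecP.[]=⇒lookup (P⊆Q (VecP.lookup⇒[]= i P i∈P)) = b≤b

lookup-≤⇒⊆ : ∀ {n} {P Q : Subset n} → (∀ i → Vec.lookup P i ≤ₛ Vec.lookup Q i) → P ⊆ Q
lookup-≤⇒⊆ {Q = Q} P≤Q {i} i∈P =
  VecP.lookup⇒[]= i Q (inside-≤ (subst (_≤ₛ Vec.lookup Q i) (VecP.[]=⇒lookup i∈P) (P≤Q i)))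
  where
  inside-≤ : ∀ {c} → inside ≤ₛ c → c ≡ inside
  inside-≤ b≤b = refl

fromSigned : ∀ {n} → (Fin n → ℤ) → SSet n
fromSigned x = Vec.tabulate (λ i → isOne (x i)) , Vec.tabulate (λ i → isMinusOne (x i))

Below : ∀ {n} → (Fin n → ℤ) → SSet n → Set
Below x B = ∀ i → SignedBelow (x i) (Vec.lookup (proj₁ B) i) (Vec.lookup (proj₂ B) i)

⊆±⇒below : ∀ {n} {S B : SSet n} → S ⊆± B → Below (eS S) B
⊆±⇒below {S = S} (P⊆P′ , N⊆N′) i =
  subst (λ z → SignedBelow z _ _) (sym (eS-lookup S i))
    (signed-mono (⊆⇒lookup-≤ P⊆P′ i) (⊆⇒lookup-≤ N⊆N′ i))

fromSigned-cong : ∀ {n} {x y : Fin n → ℤ} → (∀ i → x i ≡ y i) → fromSigned x ≡ fromSigned y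
fromSigned-cong x≡y = cong₂ _,_ (VecP.tabulate-cong (λ i → cong isOne (x≡y i)))
                                (VecP.tabulate-cong (λ i → cong isMinusOne (x≡y i)))

fromSigned-eS : ∀ {n} {S : SSet n} → Admissible S → fromSigned (eS S) ≡ S
fromSigned-eS {S = S@(P , N)} adm =
  cong₂ _,_ (trans (VecP.tabulate-cong isOne∘eS) (VecP.tabulate∘lookup P))
            (trans (VecP.tabulate-cong isMinusOne∘eS) (VecP.tabulate∘lookup N))
  where
  isOne∘eS : ∀ i → isOne (eS S i) ≡ Vec.lookup P i
  isOne∘eS i = trans (cong isOne (eS-lookup S i)) (isOne-signed (admissible⇒disjoint adm i))
  isMinusOne∘eS : ∀ i → isMinusOne (eS S i) ≡ Vec.lookup N i
  isMinusOne∘eS i = trans (cong isMinusOne (eS-lookup S i)) (isMinusOne-signed (admissible⇒disjoint adm i))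

eS-fromSigned : ∀ {n} {x : Fin n → ℤ} {B} → Below x B → ∀ i → eS (fromSigned x) i ≡ x i
eS-fromSigned {x = x} x≼B i = begin
  eS (fromSigned x) i
    ≡⟨ eS-lookup (fromSigned x) i ⟩
  signed (Vec.lookup (proj₁ (fromSigned x)) i) (Vec.lookup (proj₂ (fromSigned x)) i)
    ≡⟨ cong₂ signed (VecP.lookup∘tabulate _ i) (VecP.lookup∘tabulate _ i) ⟩
  signed (isOne (x i)) (isMinusOne (x i))
    ≡⟨ signed-isOne-isMinusOne (x≼B i) ⟩
  x i ∎
  where open ≡-Reasoning

fromSigned-admissible : ∀ {n} (x : Fin n → ℤ) → Admissible (fromSigned x)
fromSigned-admissible x = disjoint⇒admissible λ i →
  subst₂ DisjointSides (sym (VecP.lookup∘tabulate _ i)) (sym (VecP.lookup∘tabulate _ i))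
    (isOne-isMinusOne-disjoint (x i))

fromSigned-⊆± : ∀ {n} {x : Fin n → ℤ} {B} → Below x B → fromSigned x ⊆± B
fromSigned-⊆± x≼B =
    lookup-≤⇒⊆ (λ i → subst (_≤ₛ _) (sym (VecP.lookup∘tabulate _ i)) (isOne-≤ (x≼B i)))
  , lookup-≤⇒⊆ (λ i → subst (_≤ₛ _) (sym (VecP.lookup∘tabulate _ i)) (isMinusOne-≤ (x≼B i)))

independent⇒inHalfSum : ∀ {n} {F : List (SSet n)} → (∀ B → B List.∈ F → Admissible B) →
                        ∀ {S} → Independent F S → InHalfSum F (eS S)
independent⇒inHalfSum {F = F} feasible⇒adm {S} (_ , B , B∈F , S⊆B) =
  dirac k , dirac-nonNeg k , sumℚ-dirac k , coordinate
  where
  k = index B∈F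
  coordinate : ∀ i → In□ (ℤtoℚ (+ 2 ℤ.* eS S i) - sumℚ (λ j → dirac k j * ℤtoℚ (eS (lookup F j) i)))
  coordinate i
    rewrite sumℚ-dirac-* k (λ j → ℤtoℚ (eS (lookup F j) i)) | sym (lookup-index B∈F) | eS-lookup B i
    = signedBelow-In□ (admissible⇒disjoint (feasible⇒adm B B∈F) i) (⊆±⇒below S⊆B i)

eS-injective : ∀ {n} {S T : SSet n} → Admissible S → Admissible T →
               (∀ i → eS S i ≡ eS T i) → S ≡ T
eS-injective {S = S} {T} S-adm T-adm eS≡eT = begin
  S                ≡⟨ fromSigned-eS S-adm ⟨
  fromSigned (eS S) ≡⟨ fromSigned-cong eS≡eT ⟩
  fromSigned (eS T) ≡⟨ fromSigned-eS T-adm ⟩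
  T                ∎
  where open ≡-Reasoning

inHalfSum⇒below : ∀ {n} {F : List (SSet n)} {x : Fin n → ℤ} → InHalfSum F x →
                  ∃[ B ] (B List.∈ F × Below x B)
inHalfSum⇒below {F = F} {x} (l , l≥0 , Σl≡1 , 2x-p∈□) = B , ∈-lookup k , coordinate
  where
  k    = proj₁ (∃-positive l l≥0 Σl≡1)
  0<lk = proj₂ (∃-positive l l≥0 Σl≡1)
  B    = lookup F k
  coordinate : Below x B
  coordinate i = signedBelow-intro _ _ (refine (halfSum-coordinate (x i) p p∈□ (2x-p∈□ i)))
    where
    v : Fin _ → ℚ
    v j = ℤtoℚ (eS (lookup F j) i)
    v∈□ : ∀ j → In□ (v j)
    v∈□ j = subst (λ z → In□ (ℤtoℚ z)) (sym (eS-lookup (lookup F j) i))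
                (signed-In□ (Vec.lookup (proj₁ (lookup F j)) i) (Vec.lookup (proj₂ (lookup F j)) i))
    p = sumℚ (λ j → l j * v j)
    p∈□ : In□ p
    p∈□ = convex-In□ l l≥0 Σl≡1 v v∈□
    vk = ℤtoℚ (signed (Vec.lookup (proj₁ B) i) (Vec.lookup (proj₂ B) i))
    v-k : v k ≡ vk
    v-k = cong ℤtoℚ (eS-lookup B i)
    refine : (x i ≡ + 0) ⊎ ((x i ≡ + 1) × (1ℚ ≤ p)) ⊎ ((x i ≡ -[1+ 0 ]) × (p ≤ - 1ℚ)) →
             (x i ≡ + 0) ⊎ ((x i ≡ + 1) × (1ℚ ≤ vk)) ⊎ ((x i ≡ -[1+ 0 ]) × (vk ≤ - 1ℚ))
    refine (inj₁ xi≡0)                  = inj₁ xi≡0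
    refine (inj₂ (inj₁ (xi≡1 , 1≤p)))   = inj₂ (inj₁ (xi≡1 , subst (1ℚ ≤_) v-k
      (convex-≥1 l l≥0 Σl≡1 v (λ j → proj₂ (v∈□ j)) 1≤p k 0<lk)))
    refine (inj₂ (inj₂ (xi≡-1 , p≤-1))) = inj₂ (inj₂ (xi≡-1 , subst (_≤ - 1ℚ) v-k
      (convex-≤-1 l l≥0 Σl≡1 v (λ j → proj₁ (v∈□ j)) p≤-1 k 0<lk)))

proposition3p6 : (n : ℕ) (F : List (SSet n)) → IsDeltaMatroid n F →
    ((S : SSet n) → Independent F S → InHalfSum F (eS S)) ×
    ((S T : SSet n) → Independent F S → Independent F T →
    (∀ i → eS S i ≡ eS T i) → S ≡ T) ×
    ((x : Fin n → ℤ) → InHalfSum F x →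
    ∃[ S ] (Independent F S × (∀ i → eS S i ≡ x i)))
proposition3p6 n F (_ , feasible , _) =
    (λ S → independent⇒inHalfSum feasible⇒admissible)
  , (λ S T S-ind T-ind → eS-injective (proj₁ S-ind) (proj₁ T-ind))
  , λ x x∈½[P+□] →
      let (B , B∈F , x≼B) = inHalfSum⇒below x∈½[P+□]
      in fromSigned x , (fromSigned-admissible x , B , B∈F , fromSigned-⊆± x≼B) , eS-fromSigned {B = B} x≼B
  where
  feasible⇒admissible : ∀ B → B List.∈ F → Admissible B
  feasible⇒admissible B B∈F = proj₁ (feasible B B∈F)
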